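{- Let $\Delta$ be a nonempty finite set of formulas in $For_2$. Then the sequent $\Rightarrow\Delta$ (with empty antecedent) is not provable in $\mathbf{B}$.
   Context: Fix a denumerable set $prop$ of propositional variables. $For_2$ is the set of formulas built from $prop$ with unary $\lnot$ and binary $\wedge$. $var(\alpha)$ is the set of propositional variables in $\alpha$; $var(\Gamma)=\bigcup_{\gamma\in\Gamma}var(\gamma)$. A sequent $\Gamma\Rightarrow\Delta$ is an ordered pair of finite sets of formulas, not both empty; $\Rightarrow\Delta$ denotes $\emptyset\Rightarrow\Delta$; $\alpha,\Gamma$ denotes $\Gamma\cup\{\alpha\}$. The calculus $\mathbf{B}$ has the axiom $\alpha\Rightarrow\alpha$ and the rules (premises / conclusion): (W$\Rightarrow$) $\Gamma\Rightarrow\Delta$ / $\alpha,\Gamma\Rightarrow\Delta$; ($\Rightarrow$W) $\Gamma\Rightarrow\Delta$ / $\Gamma\Rightarrow\Delta,\alpha$; (Cut) $\Gamma\Rightarrow\Delta,\alpha$ and $\alpha,\Gamma\Rightarrow\Delta$ / $\Gamma\Rightarrow\Delta$; ($\lnot\Rightarrow$) $\Gamma\Rightarrow\Delta,\alpha$ / $\lnot\alpha,\Gamma\Rightarrow\Delta$; ($\Rightarrow\lnot^B$) $\alpha,\Gamma\Rightarrow\Delta$ / $\Gamma\Rightarrow\Delta,\lnot\alpha$, allowed only if $var(\alpha)\subseteq var(\Gamma)$; ($\wedge\Rightarrow$) $\alpha_1,\alpha_2,\Gamma\Rightarrow\Delta$ / $\alpha_1\wedge\alpha_2,\Gamma\Rightarrow\Delta$;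 ($\Rightarrow\wedge$) $\Gamma\Rightarrow\Delta,\alpha_1$ and $\Gamma\Rightarrow\Delta,\alpha_2$ / $\Gamma\Rightarrow\Delta,\alpha_1\wedge\alpha_2$. -}

module Defs where

open import Data.Nat using (ℕ)
open import Data.List using (List; []; _∷_; _++_)
open import Data.List.Membership.Propositional using (_∈_)
open import Data.Product using (_×_)
open import Data.Sum using (_⊎_)
open import Relation.Nullary using (¬_)
open import Relation.Binary.PropositionalEquality using (_≡_)

Prop : Set
Prop = ℕ

data Form : Set where
  var : Prop → Form
  ¬'_ : Form → Form
  _∧'_ : Form → Form → Form

-- var(α) as a list (membership is what matters)
vars : Form → List Prop
vars (var p) = p ∷ []
vars (¬' a) = vars a
vars (a ∧' b) = vars a ++ vars b

varsL : List Form → List Prop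
varsL [] = []
varsL (a ∷ Γ) = vars a ++ varsL Γ

-- finite sets of formulas are represented by lists, read up to
-- having the same members (set equality)
_≈ₛ_ : List Form → List Form → Set
Γ ≈ₛ Γ' = (∀ {a} → a ∈ Γ → a ∈ Γ') × (∀ {a} → a ∈ Γ' → a ∈ Γ)

NonEmptySeq : List Form → List Form → Set
NonEmptySeq Γ Δ = ¬ (Γ ≡ []) ⊎ ¬ (Δ ≡ [])

-- the calculus B;  α , Γ  is rendered  α ∷ Γ  (= Γ ∪ {α} up to ≈ₛ)
data B⊢ : List Form → List Form → Set where
  ax   : ∀ a → B⊢ (a ∷ []) (a ∷ [])
  -- sequents are sets: provability respects set equality
  sets : ∀ {Γ Γ' Δ Δ'} → Γ ≈ₛ Γ' → Δ ≈ₛ Δ' → B⊢ Γ Δ → B⊢ Γ' Δ'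
  wl   : ∀ {Γ Δ} a → B⊢ Γ Δ → B⊢ (a ∷ Γ) Δ
  wr   : ∀ {Γ Δ} a → B⊢ Γ Δ → B⊢ Γ (a ∷ Δ)
  cut  : ∀ {Γ Δ} a → NonEmptySeq Γ Δ →
         B⊢ Γ (a ∷ Δ) → B⊢ (a ∷ Γ) Δ → B⊢ Γ Δ
  negL : ∀ {Γ Δ} a → B⊢ Γ (a ∷ Δ) → B⊢ ((¬' a) ∷ Γ) Δ
  negR : ∀ {Γ Δ} a → (∀ {p} → p ∈ vars a → p ∈ varsL Γ) →
         B⊢ (a ∷ Γ) Δ → B⊢ Γ ((¬' a) ∷ Δ)
  andL : ∀ {Γ Δ} a b → B⊢ (a ∷ b ∷ Γ) Δ → B⊢ ((a ∧' b) ∷ Γ) Δ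
  andR : ∀ {Γ Δ} a b → B⊢ Γ (a ∷ Δ) → B⊢ Γ (b ∷ Δ) → B⊢ Γ ((a ∧' b) ∷ Δ)

module Submission where

-- The proof is a soundness argument for a strengthened, "variable-relevant"
-- reading of sequents.  Call  Γ ⇒ Δ  relevantly valid if for every valuation
-- v making all of Γ true there is a formula d ∈ Δ that is true under v and
-- whose variables all occur in Γ.  Every rule of B preserves relevant
-- validity; the side condition var(α) ⊆ var(Γ) of (⇒¬ᴮ) is exactly what makes
-- the rule for negation on the right sound in this sense.  For Γ = [] the
-- witness d would have to be a formula without variables, and every formula
-- of For₂ contains a variable.

open import Defs
open import Data.Bool using (Bool; true; false; not; _∧_; T)
open import Data.Bool.Properties using (T-∧)
open import Data.Empty using (⊥)
open import Data.List using (List; []; _∷_; _++_; concatMap)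
open import Data.List.Properties using (++-assoc)
open import Data.List.Membership.Propositional.Properties using (∈-++⁻)
open import Data.List.Relation.Binary.Subset.Propositional using (_⊆_)
open import Data.List.Relation.Binary.Subset.Propositional.Properties
  using (⊆-refl; ⊆-trans; ⊆-reflexive; xs⊆xs++ys; xs⊆ys++xs; concatMap⁺; Any-resp-⊆)
open import Data.List.Relation.Unary.All using (All; []; _∷_)
open import Data.List.Relation.Unary.All.Properties using (anti-mono)
open import Data.List.Relation.Unary.Any as Any using (Any; here; there)
open import Data.Product using (_×_; _,_)
open import Data.Sum using (_⊎_; inj₁; inj₂; [_,_]′)
open import Data.Unit using (tt)
open import Function using (_∘_; Equivalence)
open import Relation.Nullary using (¬_)
open import Relation.Binary.PropositionalEquality using (_≡_; refl; sym)

-- var(Γ) is the concatenation of the var(γ), which lets us reuse the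
-- library's monotonicity of concatMap.
varsL≡concatMap : ∀ Γ → varsL Γ ≡ concatMap vars Γ
varsL≡concatMap []      = refl
varsL≡concatMap (a ∷ Γ) rewrite varsL≡concatMap Γ = refl

varsL-mono : ∀ {Γ Γ'} → Γ ⊆ Γ' → varsL Γ ⊆ varsL Γ'
varsL-mono {Γ} {Γ'} Γ⊆Γ' =
  ⊆-trans (⊆-reflexive (varsL≡concatMap Γ))
    (⊆-trans (concatMap⁺ vars Γ⊆Γ') (⊆-reflexive (sym (varsL≡concatMap Γ'))))

varsL-extend : ∀ a Γ → varsL Γ ⊆ varsL (a ∷ Γ)
varsL-extend a Γ = xs⊆ys++xs (varsL Γ) (vars a)

++-lub : ∀ {xs ys zs : List Prop} → xs ⊆ zs → ys ⊆ zs → xs ++ ys ⊆ zs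
++-lub {xs} xs⊆zs ys⊆zs = [ xs⊆zs , ys⊆zs ]′ ∘ ∈-++⁻ xs

varsL-absorb : ∀ a Γ → vars a ⊆ varsL Γ → varsL (a ∷ Γ) ⊆ varsL Γ
varsL-absorb _ _ a⊆Γ = ++-lub a⊆Γ ⊆-refl

varsL-∧ : ∀ a b Γ → varsL (a ∷ b ∷ Γ) ⊆ varsL ((a ∧' b) ∷ Γ)
varsL-∧ a b Γ = ⊆-reflexive (sym (++-assoc (vars a) (vars b) (varsL Γ)))

vars-nonempty : ∀ a → ¬ (vars a ⊆ [])
vars-nonempty (var p)  p⊆[] with p⊆[] (here refl)
... | ()
vars-nonempty (¬' a)   a⊆[] = vars-nonempty a a⊆[]
vars-nonempty (a ∧' b) ab⊆[] = vars-nonempty a (ab⊆[] ∘ xs⊆xs++ys (vars a) (vars b))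

Valuation : Set
Valuation = Prop → Bool

eval : Valuation → Form → Bool
eval v (var p)  = v p
eval v (¬' a)   = not (eval v a)
eval v (a ∧' b) = eval v a ∧ eval v b

T-or-T-not : ∀ b → T b ⊎ T (not b)
T-or-T-not true  = inj₁ tt
T-or-T-not false = inj₂ tt

T-and-T-not : ∀ {b} → T b → T (not b) → ⊥
T-and-T-not {true} _ ()

Witness : Valuation → List Prop → Form → Set
Witness v X d = T (eval v d) × vars d ⊆ X

RelValid : List Form → List Form → Set
RelValid Γ Δ = ∀ v → All (T ∘ eval v) Γ → Any (Witness v (varsL Γ)) Δ

widen : ∀ {v X Y Δ} → X ⊆ Y → Any (Witness v X) Δ → Any (Witness v Y) Δ
widen X⊆Y = Any.map λ (t , d⊆X) → t , ⊆-trans d⊆X X⊆Y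

sound : ∀ {Γ Δ} → B⊢ Γ Δ → RelValid Γ Δ
sound (ax a) v (t ∷ []) = here (t , xs⊆xs++ys (vars a) [])
sound (sets (Γ⊆Γ' , _) (Δ⊆Δ' , _) d) v h =
  Any-resp-⊆ Δ⊆Δ' (widen (varsL-mono Γ⊆Γ') (sound d v (anti-mono Γ⊆Γ' h)))
sound (wl {Γ} a d) v (_ ∷ h) = widen (varsL-extend a Γ) (sound d v h)
sound (wr a d) v h = there (sound d v h)
sound (cut {Γ} a _ d₁ d₂) v h with sound d₁ v h
... | there w            = w
... | here (t , a⊆Γ)     = widen (varsL-absorb a Γ a⊆Γ) (sound d₂ v (t ∷ h))
sound (negL {Γ} a d) v (t ∷ h) with sound d v h
... | there w            = widen (varsL-extend (¬' a) Γ) w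
... | here (t' , _)      with () ← T-and-T-not t' t
sound (negR {Γ} a a⊆Γ d) v h with T-or-T-not (eval v a)
... | inj₂ t             = here (t , a⊆Γ)
... | inj₁ t             = there (widen (varsL-absorb a Γ a⊆Γ) (sound d v (t ∷ h)))
sound (andL {Γ} a b d) v (t ∷ h) with Equivalence.to T-∧ t
... | ta , tb           = widen (varsL-∧ a b Γ) (sound d v (ta ∷ tb ∷ h))
sound (andR a b d₁ d₂) v h with sound d₁ v h | sound d₂ v h
... | there w            | _                  = there w
... | here _             | there w            = there w
... | here (ta , a⊆Γ)    | here (tb , b⊆Γ)    =
  here (Equivalence.from T-∧ (ta , tb) , ++-lub a⊆Γ b⊆Γ)

no-witness-without-variables : ∀ {v Δ} → ¬ Any (Witness v []) Δ
no-witness-without-variables w with Any.satisfied w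
... | d , _ , d⊆[] = vars-nonempty d d⊆[]

-- Soundness under any valuation (say the constantly true one) would produce
-- such a witness.
mainTheorem14 : (Δ : List Form) → ¬ (Δ ≡ []) → ¬ B⊢ [] Δ
mainTheorem14 Δ _ d = no-witness-without-variables (sound d (λ _ → true) [])
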